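{- Let $D_1,D_2$ be EDC-lattices such that $D_1$ is a C-separable EDC-sublattice of $D_2$. Then: (i) if $D_1$ is a dually dense sublattice of $D_2$, then $D_1$ satisfies (Ext C) iff $D_2$ satisfies (Ext C); (ii) $D_1$ satisfies (Con C) iff $D_2$ satisfies (Con C); (iii) $D_1$ satisfies (Nor 1) iff $D_2$ satisfies (Nor 1); (iv) $D_1$ satisfies (U-rich $\ll$) iff $D_2$ satisfies (U-rich $\ll$); (v) $D_1$ satisfies (U-rich $\widehat C$) iff $D_2$ satisfies (U-rich $\widehat C$).
   Context: An EDC-lattice is a structure $(D,\le,0,1,+,\cdot,C,\widehat C,\ll)$ where $(D,\le,0,1,+,\cdot)$ is a bounded distributive lattice and $C,\widehat C,\ll$ are binary relations on $D$ such that for all $a,a',b,b',c,d\in D$ (writing $\overline R$ for the complement of a relation $R$): (C1) $aCb\Rightarrow a\neq0,b\ne 0$; (C2) $aCb$, $a\le a'$, $b\le b'\Rightarrow a'Cb'$; (C3) $aC(b+c)\Rightarrow aCb$ or $aCc$; (C4) $aCb\Rightarrow bCa$; (C5) $a\cdot b\ne0\Rightarrow aCb$; ($\widehat C$1) $a\widehat Cb\Rightarrow a\ne1,b\ne1$; ($\widehat C$2) $a\widehat Cb$, $a'\le a$, $b'\le b\Rightarrow a'\widehat Cb'$; ($\widehat C$3) $a\widehat C(b\cdot c)\Rightarrow a\widehat Cb$ or $a\widehat Cc$; ($\widehat C$4) $a\widehat Cb\Rightarrow b\widehat Ca$; ($\widehat C$5) $a+b\ne1\Rightarrow a\widehat Cb$;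 ($\ll$1) $0\ll0$; ($\ll$2) $1\ll1$; ($\ll$3) $a\ll b\Rightarrow a\le b$; ($\ll$4) $a'\le a\ll b\le b'\Rightarrow a'\ll b'$; ($\ll$5) $a\ll c$, $b\ll c\Rightarrow a+b\ll c$; ($\ll$6) $c\ll a$, $c\ll b\Rightarrow c\ll a\cdot b$; ($\ll$7) $a\ll b$, $b\cdot c\ll d$, $c\ll a+d\Rightarrow c\ll d$; (MC1) $aCb$, $a\ll c\Rightarrow aC(b\cdot c)$; (MC2) $a\overline C(b\cdot c)$, $aCb$, $(a\cdot d)\overline Cb\Rightarrow d\widehat Cc$; (M$\widehat C$1) $a\widehat Cb$, $c\ll a\Rightarrow a\widehat C(b+c)$; (M$\widehat C$2) $a\overline{\widehat C}(b+c)$, $a\widehat Cb$, $(a+d)\overline{\widehat C}b\Rightarrow dCc$; (M$\ll$1) $a\overline{\widehat C}b$, $a\cdot c\ll b\Rightarrow c\ll b$; (M$\ll$2) $a\overline Cb$, $b\ll a+c\Rightarrow b\ll c$. $D_1$ is an EDC-sublattice of $D_2$ if $D_1$ is a bounded sublattice of $D_2$ and $C,\widehat C,\ll$ of $D_1$ are the restrictions of those of $D_2$. It is dually dense if for every $a_2\in D_2$ with $a_2\ne1$ there is $a_1\in D_1$ with $a_2\le a_1\ne1$. It is C-separable if for all $a_2,b_2\in D_2$: (a) $a_2\overline Cb_2\Rightarrow\exists a_1,b_1\in D_1\,(a_2\le a_1,\ b_2\le b_1,\ a_1\overline Cb_1)$; (b) $a_2\overline{\widehat C}b_2\Rightarrow\exists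 a_1,b_1\in D_1\,(a_2+a_1=1,\ b_2+b_1=1,\ a_1\overline Cb_1)$; (c) $a_2\ll b_2\Rightarrow\exists a_1,b_1\in D_1\,(a_2\le a_1,\ b_2+b_1=1,\ a_1\overline Cb_1)$. Axioms: (Ext C) $a\ne1\Rightarrow\exists b\ne0\,(a\overline Cb)$; (Con C) $a\ne0$, $b\ne0$, $a+b=1\Rightarrow aCb$; (Nor 1) $a\overline Cb\Rightarrow\exists c,d\,(c+d=1,\ a\overline Cc,\ b\overline Cd)$; (U-rich $\ll$) $a\ll b\Rightarrow\exists c\,(b+c=1,\ a\overline Cc)$; (U-rich $\widehat C$) $a\overline{\widehat C}b\Rightarrow\exists c,d\,(a+c=1,\ b+d=1,\ c\overline Cd)$. -}

module Defs where

open import Level using (Level; suc; _⊔_)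
open import Data.Product using (Σ; ∃; _×_; _,_)
open import Data.Sum using (_⊎_)
open import Relation.Nullary using (¬_)
open import Relation.Binary.PropositionalEquality using (_≡_)
open import Algebra.Lattice.Structures using (IsDistributiveLattice)
open import Function.Bundles using (_⇔_)

record EDCLattice (c ℓ : Level) : Set (suc (c ⊔ ℓ)) where
  infixl 6 _+_
  infixl 7 _·_
  infix 4 _≤_ _C_ _Ĉ_ _≪_
  field
    Carrier : Set c
    _+_ _·_ : Carrier → Carrier → Carrier
    𝟎 𝟏 : Carrier
    isDistributiveLattice : IsDistributiveLattice {A = Carrier} _≡_ _+_ _·_
    +-identityʳ : ∀ a → a + 𝟎 ≡ a
    ·-identityʳ : ∀ a → a · 𝟏 ≡ a
    _C_ _Ĉ_ _≪_ : Carrier → Carrier → Set ℓ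

  _≤_ : Carrier → Carrier → Set c
  a ≤ b = a + b ≡ b

  _C̄_ : Carrier → Carrier → Set ℓ
  a C̄ b = ¬ (a C b)

  _Ĉ̄_ : Carrier → Carrier → Set ℓ
  a Ĉ̄ b = ¬ (a Ĉ b)

  field
    C1 : ∀ {a b} → a C b → ¬ (a ≡ 𝟎) × ¬ (b ≡ 𝟎)
    C2 : ∀ {a a' b b'} → a C b → a ≤ a' → b ≤ b' → a' C b'
    C3 : ∀ {a b c} → a C (b + c) → a C b ⊎ a C c
    C4 : ∀ {a b} → a C b → b C a
    C5 : ∀ {a b} → ¬ (a · b ≡ 𝟎) → a C b
    Ĉ1 : ∀ {a b} → a Ĉ b → ¬ (a ≡ 𝟏) × ¬ (b ≡ 𝟏)
    Ĉ2 : ∀ {a a' b b'} → a Ĉ b → a' ≤ a → b' ≤ b → a' Ĉ b'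
    Ĉ3 : ∀ {a b c} → a Ĉ (b · c) → a Ĉ b ⊎ a Ĉ c
    Ĉ4 : ∀ {a b} → a Ĉ b → b Ĉ a
    Ĉ5 : ∀ {a b} → ¬ (a + b ≡ 𝟏) → a Ĉ b
    ≪1 : 𝟎 ≪ 𝟎
    ≪2 : 𝟏 ≪ 𝟏
    ≪3 : ∀ {a b} → a ≪ b → a ≤ b
    ≪4 : ∀ {a a' b b'} → a' ≤ a → a ≪ b → b ≤ b' → a' ≪ b'
    ≪5 : ∀ {a b c} → a ≪ c → b ≪ c → a + b ≪ c
    ≪6 : ∀ {a b c} → c ≪ a → c ≪ b → c ≪ a · b
    ≪7 : ∀ {a b c d} → a ≪ b → b · c ≪ d → c ≪ a + d → c ≪ d
    MC1 : ∀ {a b c} → a C b → a ≪ c → a C (b · c)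
    MC2 : ∀ {a b c d} → a C̄ (b · c) → a C b → (a · d) C̄ b → d Ĉ c
    MĈ1 : ∀ {a b c} → a Ĉ b → c ≪ a → a Ĉ (b + c)
    MĈ2 : ∀ {a b c d} → a Ĉ̄ (b + c) → a Ĉ b → (a + d) Ĉ̄ b → d C c
    M≪1 : ∀ {a b c} → a Ĉ̄ b → a · c ≪ b → c ≪ b
    M≪2 : ∀ {a b c} → a C̄ b → b ≪ a + c → b ≪ c

module _ {c ℓ : Level} (D : EDCLattice c ℓ) where
  open EDCLattice D

  ExtC : Set (c ⊔ ℓ)
  ExtC = ∀ a → ¬ (a ≡ 𝟏) → Σ Carrier λ b → ¬ (b ≡ 𝟎) × a C̄ b

  ConC : Set (c ⊔ ℓ)
  ConC = ∀ a b → ¬ (a ≡ 𝟎) → ¬ (b ≡ 𝟎) → a + b ≡ 𝟏 → a C b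

  Nor1 : Set (c ⊔ ℓ)
  Nor1 = ∀ a b → a C̄ b →
    Σ Carrier λ c' → Σ Carrier λ d → (c' + d ≡ 𝟏) × a C̄ c' × b C̄ d

  URich≪ : Set (c ⊔ ℓ)
  URich≪ = ∀ a b → a ≪ b → Σ Carrier λ c' → (b + c' ≡ 𝟏) × a C̄ c'

  URichĈ : Set (c ⊔ ℓ)
  URichĈ = ∀ a b → a Ĉ̄ b →
    Σ Carrier λ c' → Σ Carrier λ d → (a + c' ≡ 𝟏) × (b + d ≡ 𝟏) × c' C̄ d

record IsEDCSublattice {c₁ ℓ₁ c₂ ℓ₂ : Level}
    (D₁ : EDCLattice c₁ ℓ₁) (D₂ : EDCLattice c₂ ℓ₂) : Set (c₁ ⊔ ℓ₁ ⊔ c₂ ⊔ ℓ₂) where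
  private
    module D₁ = EDCLattice D₁
    module D₂ = EDCLattice D₂
  field
    ι : D₁.Carrier → D₂.Carrier
    ι-injective : ∀ {a b} → ι a ≡ ι b → a ≡ b
    ι-𝟎 : ι D₁.𝟎 ≡ D₂.𝟎
    ι-𝟏 : ι D₁.𝟏 ≡ D₂.𝟏
    ι-+ : ∀ a b → ι (a D₁.+ b) ≡ ι a D₂.+ ι b
    ι-· : ∀ a b → ι (a D₁.· b) ≡ ι a D₂.· ι b
    ι-C : ∀ a b → (a D₁.C b) ⇔ (ι a D₂.C ι b)
    ι-Ĉ : ∀ a b → (a D₁.Ĉ b) ⇔ (ι a D₂.Ĉ ι b)
    ι-≪ : ∀ a b → (a D₁.≪ b) ⇔ (ι a D₂.≪ ι b)

module _ {c₁ ℓ₁ c₂ ℓ₂ : Level} {D₁ : EDCLattice c₁ ℓ₁} {D₂ : EDCLattice c₂ ℓ₂}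
    (S : IsEDCSublattice D₁ D₂) where
  private
    module D₁ = EDCLattice D₁
    module D₂ = EDCLattice D₂
  open IsEDCSublattice S

  DuallyDense : Set (c₁ ⊔ c₂)
  DuallyDense = ∀ (a₂ : D₂.Carrier) → ¬ (a₂ ≡ D₂.𝟏) →
    Σ D₁.Carrier λ a₁ → (a₂ D₂.≤ ι a₁) × ¬ (ι a₁ ≡ D₂.𝟏)

  CSeparable : Set (c₁ ⊔ c₂ ⊔ ℓ₂)
  CSeparable =
    (∀ (a₂ b₂ : D₂.Carrier) → a₂ D₂.C̄ b₂ →
      Σ D₁.Carrier λ a₁ → Σ D₁.Carrier λ b₁ →
        (a₂ D₂.≤ ι a₁) × (b₂ D₂.≤ ι b₁) × (ι a₁ D₂.C̄ ι b₁))
    × (∀ (a₂ b₂ : D₂.Carrier) → a₂ D₂.Ĉ̄ b₂ →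
      Σ D₁.Carrier λ a₁ → Σ D₁.Carrier λ b₁ →
        (a₂ D₂.+ ι a₁ ≡ D₂.𝟏) × (b₂ D₂.+ ι b₁ ≡ D₂.𝟏) × (ι a₁ D₂.C̄ ι b₁))
    × (∀ (a₂ b₂ : D₂.Carrier) → a₂ D₂.≪ b₂ →
      Σ D₁.Carrier λ a₁ → Σ D₁.Carrier λ b₁ →
        (a₂ D₂.≤ ι a₁) × (b₂ D₂.+ ι b₁ ≡ D₂.𝟏) × (ι a₁ D₂.C̄ ι b₁))

-- The transfer runs through C-separability (a), which enlarges the two sides
-- of a non-contact in D₂ to elements of D₁ that are still not in contact;
-- enlarging preserves "x + y = 1" and non-zeroness.  Going down, a witness
-- found in D₂ is replaced by such a D₁-element above it; going up, the data
-- is enlarged into D₁, the property is applied there and the result is read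
-- back through ι (for Ext C dual density does the enlarging, and Con C is
-- obtained by contradiction).  The U-rich properties even hold in D₂
-- outright: separations (b) and (c) provide exactly their witnesses.
module Submission where

open import Defs
open import Level using (Level; _⊔_)
open import Data.Product using (_×_; _,_; Σ)
open import Function using (const; _∘_)
open import Function.Bundles using (_⇔_; mk⇔; Equivalence)
open import Axiom.ExcludedMiddle using (ExcludedMiddle)
open import Relation.Nullary using (¬_)
open import Relation.Nullary.Decidable using (decidable-stable)
open import Relation.Binary.PropositionalEquality
open import Algebra.Bundles using (CommutativeSemigroup)
open import Algebra.Lattice.Bundles using (Lattice)
open import Algebra.Lattice.Structures using (IsDistributiveLattice)
import Algebra.Lattice.Properties.Lattice as LatticeProperties
import Algebra.Properties.CommutativeSemigroup as CommutativeSemigroupProperties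

module EDCLatticeProperties {c ℓ : Level} (D : EDCLattice c ℓ) where
  open EDCLattice D
  open IsDistributiveLattice isDistributiveLattice
    using (isLattice; ∨-comm; ∧-comm; ∨-absorbs-∧)
  open ≡-Reasoning

  lattice : Lattice c c
  lattice = record { isLattice = isLattice }

  open LatticeProperties lattice using (∨-idem; ∨-isSemigroup)

  +-commutativeSemigroup : CommutativeSemigroup c c
  +-commutativeSemigroup = record
    { isCommutativeSemigroup = record { isSemigroup = ∨-isSemigroup ; comm = ∨-comm } }

  open CommutativeSemigroupProperties +-commutativeSemigroup using (interchange)

  ≤-refl : ∀ a → a ≤ a
  ≤-refl = ∨-idem

  +-mono-≤ : ∀ {a a' b b'} → a ≤ a' → b ≤ b' → a + b ≤ a' + b'
  +-mono-≤ {a} {a'} {b} {b'} a≤a' b≤b' = begin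
    (a + b) + (a' + b')  ≡⟨ interchange a b a' b' ⟩
    (a + a') + (b + b')  ≡⟨ cong₂ _+_ a≤a' b≤b' ⟩
    a' + b'              ∎

  𝟏-+ : ∀ a → 𝟏 + a ≡ 𝟏
  𝟏-+ a = begin
    𝟏 + a        ≡⟨ cong (𝟏 +_) (sym (trans (∧-comm 𝟏 a) (·-identityʳ a))) ⟩
    𝟏 + (𝟏 · a)  ≡⟨ ∨-absorbs-∧ 𝟏 a ⟩
    𝟏            ∎

  ≡𝟏-mono-≤ : ∀ {a b} → a ≤ b → a ≡ 𝟏 → b ≡ 𝟏
  ≡𝟏-mono-≤ {b = b} a≤b refl = trans (sym a≤b) (𝟏-+ b)

  ≤𝟎⇒≡𝟎 : ∀ {a} → a ≤ 𝟎 → a ≡ 𝟎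
  ≤𝟎⇒≡𝟎 {a} a≤𝟎 = trans (sym (+-identityʳ a)) a≤𝟎

  +≡𝟏-mono-≤ : ∀ {a a' b b'} → a + b ≡ 𝟏 → a ≤ a' → b ≤ b' → a' + b' ≡ 𝟏
  +≡𝟏-mono-≤ a+b≡𝟏 a≤a' b≤b' = ≡𝟏-mono-≤ (+-mono-≤ a≤a' b≤b') a+b≡𝟏

  C̄-antitoneˡ : ∀ {a a' b} → a ≤ a' → a' C̄ b → a C̄ b
  C̄-antitoneˡ {b = b} a≤a' a'C̄b aCb = a'C̄b (C2 aCb a≤a' (≤-refl b))


module EDCSublatticeProperties {c₁ ℓ₁ c₂ ℓ₂ : Level}
    {D₁ : EDCLattice c₁ ℓ₁} {D₂ : EDCLattice c₂ ℓ₂} (S : IsEDCSublattice D₁ D₂) where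
  private
    module D₁ = EDCLattice D₁
    module D₂ = EDCLattice D₂
  open EDCLatticeProperties D₂
  open IsEDCSublattice S

  SeparatesC̄ : Set (c₁ ⊔ c₂ ⊔ ℓ₂)
  SeparatesC̄ = ∀ (a₂ b₂ : D₂.Carrier) → a₂ D₂.C̄ b₂ →
    Σ D₁.Carrier λ a₁ → Σ D₁.Carrier λ b₁ →
      (a₂ D₂.≤ ι a₁) × (b₂ D₂.≤ ι b₁) × (ι a₁ D₂.C̄ ι b₁)

  SeparatesĈ̄ : Set (c₁ ⊔ c₂ ⊔ ℓ₂)
  SeparatesĈ̄ = ∀ (a₂ b₂ : D₂.Carrier) → a₂ D₂.Ĉ̄ b₂ →
    Σ D₁.Carrier λ a₁ → Σ D₁.Carrier λ b₁ →
      (a₂ D₂.+ ι a₁ ≡ D₂.𝟏) × (b₂ D₂.+ ι b₁ ≡ D₂.𝟏) × (ι a₁ D₂.C̄ ι b₁)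

  Separates≪ : Set (c₁ ⊔ c₂ ⊔ ℓ₂)
  Separates≪ = ∀ (a₂ b₂ : D₂.Carrier) → a₂ D₂.≪ b₂ →
    Σ D₁.Carrier λ a₁ → Σ D₁.Carrier λ b₁ →
      (a₂ D₂.≤ ι a₁) × (b₂ D₂.+ ι b₁ ≡ D₂.𝟏) × (ι a₁ D₂.C̄ ι b₁)

  ι-reflects-𝟎 : ∀ {a} → ι a ≡ D₂.𝟎 → a ≡ D₁.𝟎
  ι-reflects-𝟎 ιa≡𝟎 = ι-injective (trans ιa≡𝟎 (sym ι-𝟎))

  ι-reflects-𝟏 : ∀ {a} → ι a ≡ D₂.𝟏 → a ≡ D₁.𝟏
  ι-reflects-𝟏 ιa≡𝟏 = ι-injective (trans ιa≡𝟏 (sym ι-𝟏))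

  ι-preserves-≢𝟎 : ∀ {a} → ¬ a ≡ D₁.𝟎 → ¬ ι a ≡ D₂.𝟎
  ι-preserves-≢𝟎 a≢𝟎 = a≢𝟎 ∘ ι-reflects-𝟎

  ι-preserves-≢𝟏 : ∀ {a} → ¬ a ≡ D₁.𝟏 → ¬ ι a ≡ D₂.𝟏
  ι-preserves-≢𝟏 a≢𝟏 = a≢𝟏 ∘ ι-reflects-𝟏

  ι-reflects-≢𝟏 : ∀ {a} → ¬ ι a ≡ D₂.𝟏 → ¬ a ≡ D₁.𝟏
  ι-reflects-≢𝟏 ιa≢𝟏 a≡𝟏 = ιa≢𝟏 (trans (cong ι a≡𝟏) ι-𝟏)

  ≢𝟎-below-ι : ∀ {x a} → x D₂.≤ ι a → ¬ x ≡ D₂.𝟎 → ¬ a ≡ D₁.𝟎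
  ≢𝟎-below-ι x≤ιa x≢𝟎 refl = x≢𝟎 (≤𝟎⇒≡𝟎 (subst (_ D₂.≤_) ι-𝟎 x≤ιa))

  ι-preserves-+≡𝟏 : ∀ {a b} → a D₁.+ b ≡ D₁.𝟏 → ι a D₂.+ ι b ≡ D₂.𝟏
  ι-preserves-+≡𝟏 {a} {b} a+b≡𝟏 = trans (sym (ι-+ a b)) (trans (cong ι a+b≡𝟏) ι-𝟏)

  +≡𝟏-below-ι : ∀ {x y a b} → x D₂.+ y ≡ D₂.𝟏 → x D₂.≤ ι a → y D₂.≤ ι b →
    a D₁.+ b ≡ D₁.𝟏
  +≡𝟏-below-ι {a = a} {b} x+y≡𝟏 x≤ιa y≤ιb =
    ι-reflects-𝟏 (trans (ι-+ a b) (+≡𝟏-mono-≤ x+y≡𝟏 x≤ιa y≤ιb))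

  ι-preserves-C : ∀ {a b} → a D₁.C b → ι a D₂.C ι b
  ι-preserves-C {a} {b} = Equivalence.to (ι-C a b)

  ι-reflects-C : ∀ {a b} → ι a D₂.C ι b → a D₁.C b
  ι-reflects-C {a} {b} = Equivalence.from (ι-C a b)

  ι-preserves-C̄ : ∀ {a b} → a D₁.C̄ b → ι a D₂.C̄ ι b
  ι-preserves-C̄ aC̄b = aC̄b ∘ ι-reflects-C

  ι-reflects-C̄ : ∀ {a b} → ι a D₂.C̄ ι b → a D₁.C̄ b
  ι-reflects-C̄ ιaC̄ιb = ιaC̄ιb ∘ ι-preserves-C

  ι-preserves-Ĉ̄ : ∀ {a b} → a D₁.Ĉ̄ b → ι a D₂.Ĉ̄ ι b
  ι-preserves-Ĉ̄ {a} {b} aĈ̄b = aĈ̄b ∘ Equivalence.from (ι-Ĉ a b)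

  ι-preserves-≪ : ∀ {a b} → a D₁.≪ b → ι a D₂.≪ ι b
  ι-preserves-≪ {a} {b} = Equivalence.to (ι-≪ a b)

  extC-up : DuallyDense S → ExtC D₁ → ExtC D₂
  extC-up dense ext a₂ a₂≢𝟏 =
    let a₁ , a₂≤ιa₁ , ιa₁≢𝟏 = dense a₂ a₂≢𝟏
        b₁ , b₁≢𝟎 , a₁C̄b₁ = ext a₁ (ι-reflects-≢𝟏 ιa₁≢𝟏)
    in ι b₁ , ι-preserves-≢𝟎 b₁≢𝟎 , C̄-antitoneˡ a₂≤ιa₁ (ι-preserves-C̄ a₁C̄b₁)

  conC-down : ConC D₂ → ConC D₁
  conC-down con a b a≢𝟎 b≢𝟎 a+b≡𝟏 = ι-reflects-C
    (con (ι a) (ι b) (ι-preserves-≢𝟎 a≢𝟎) (ι-preserves-≢𝟎 b≢𝟎) (ι-preserves-+≡𝟏 a+b≡𝟏))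

  uRich≪ : Separates≪ → URich≪ D₂
  uRich≪ sep≪ a₂ b₂ a₂≪b₂ =
    let a₁ , b₁ , a₂≤ιa₁ , b₂+ιb₁≡𝟏 , ιa₁C̄ιb₁ = sep≪ a₂ b₂ a₂≪b₂
    in ι b₁ , b₂+ιb₁≡𝟏 , C̄-antitoneˡ a₂≤ιa₁ ιa₁C̄ιb₁

  uRichĈ : SeparatesĈ̄ → URichĈ D₂
  uRichĈ sepĈ a₂ b₂ a₂Ĉ̄b₂ =
    let a₁ , b₁ , a₂+ιa₁≡𝟏 , b₂+ιb₁≡𝟏 , ιa₁C̄ιb₁ = sepĈ a₂ b₂ a₂Ĉ̄b₂
    in ι a₁ , ι b₁ , a₂+ιa₁≡𝟏 , b₂+ιb₁≡𝟏 , ιa₁C̄ιb₁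

  module _ (sepC : SeparatesC̄) where

    C̄-coverʳ : ∀ {a c₂} → ι a D₂.C̄ c₂ → Σ D₁.Carrier λ c → (c₂ D₂.≤ ι c) × (a D₁.C̄ c)
    C̄-coverʳ {a} {c₂} ιaC̄c₂ =
      let a₁ , c , ιa≤ιa₁ , c₂≤ιc , ιa₁C̄ιc = sepC (ι a) c₂ ιaC̄c₂
      in c , c₂≤ιc , ι-reflects-C̄ (C̄-antitoneˡ ιa≤ιa₁ ιa₁C̄ιc)

    extC-down : ExtC D₂ → ExtC D₁
    extC-down ext a a≢𝟏 =
      let b₂ , b₂≢𝟎 , ιaC̄b₂ = ext (ι a) (ι-preserves-≢𝟏 a≢𝟏)
          b , b₂≤ιb , aC̄b = C̄-coverʳ ιaC̄b₂
      in b , ≢𝟎-below-ι b₂≤ιb b₂≢𝟎 , aC̄b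

    conC-up : ExcludedMiddle ℓ₂ → ConC D₁ → ConC D₂
    conC-up em con a₂ b₂ a₂≢𝟎 b₂≢𝟎 a₂+b₂≡𝟏 = decidable-stable em λ a₂C̄b₂ →
      let a₁ , b₁ , a₂≤ιa₁ , b₂≤ιb₁ , ιa₁C̄ιb₁ = sepC a₂ b₂ a₂C̄b₂
      in ιa₁C̄ιb₁ (ι-preserves-C (con a₁ b₁
           (≢𝟎-below-ι a₂≤ιa₁ a₂≢𝟎) (≢𝟎-below-ι b₂≤ιb₁ b₂≢𝟎)
           (+≡𝟏-below-ι a₂+b₂≡𝟏 a₂≤ιa₁ b₂≤ιb₁)))

    nor1-up : Nor1 D₁ → Nor1 D₂
    nor1-up nor a₂ b₂ a₂C̄b₂ =
      let a₁ , b₁ , a₂≤ιa₁ , b₂≤ιb₁ , ιa₁C̄ιb₁ = sepC a₂ b₂ a₂C̄b₂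
          c , d , c+d≡𝟏 , a₁C̄c , b₁C̄d = nor a₁ b₁ (ι-reflects-C̄ ιa₁C̄ιb₁)
      in ι c , ι d , ι-preserves-+≡𝟏 c+d≡𝟏
         , C̄-antitoneˡ a₂≤ιa₁ (ι-preserves-C̄ a₁C̄c)
         , C̄-antitoneˡ b₂≤ιb₁ (ι-preserves-C̄ b₁C̄d)

    nor1-down : Nor1 D₂ → Nor1 D₁
    nor1-down nor a b aC̄b =
      let c₂ , d₂ , c₂+d₂≡𝟏 , ιaC̄c₂ , ιbC̄d₂ = nor (ι a) (ι b) (ι-preserves-C̄ aC̄b)
          c , c₂≤ιc , aC̄c = C̄-coverʳ ιaC̄c₂
          d , d₂≤ιd , bC̄d = C̄-coverʳ ιbC̄d₂
      in c , d , +≡𝟏-below-ι c₂+d₂≡𝟏 c₂≤ιc d₂≤ιd , aC̄c , bC̄d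

    uRich≪-down : URich≪ D₂ → URich≪ D₁
    uRich≪-down urich a b a≪b =
      let c₂ , ιb+c₂≡𝟏 , ιaC̄c₂ = urich (ι a) (ι b) (ι-preserves-≪ a≪b)
          c , c₂≤ιc , aC̄c = C̄-coverʳ ιaC̄c₂
      in c , +≡𝟏-below-ι ιb+c₂≡𝟏 (≤-refl (ι b)) c₂≤ιc , aC̄c

    uRichĈ-down : URichĈ D₂ → URichĈ D₁
    uRichĈ-down urich a b aĈ̄b =
      let c₂ , d₂ , ιa+c₂≡𝟏 , ιb+d₂≡𝟏 , c₂C̄d₂ = urich (ι a) (ι b) (ι-preserves-Ĉ̄ aĈ̄b)
          c , d , c₂≤ιc , d₂≤ιd , ιcC̄ιd = sepC c₂ d₂ c₂C̄d₂
      in c , d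
         , +≡𝟏-below-ι ιa+c₂≡𝟏 (≤-refl (ι a)) c₂≤ιc
         , +≡𝟏-below-ι ιb+d₂≡𝟏 (≤-refl (ι b)) d₂≤ιd
         , ι-reflects-C̄ ιcC̄ιd

mainTheorem14 : (∀ {ℓ} → ExcludedMiddle ℓ) → ∀ {c₁ ℓ₁ c₂ ℓ₂ : Level} (D₁ : EDCLattice c₁ ℓ₁) (D₂ : EDCLattice c₂ ℓ₂)
    (S : IsEDCSublattice D₁ D₂) → CSeparable S →
    (DuallyDense S → (ExtC D₁ ⇔ ExtC D₂))
    × (ConC D₁ ⇔ ConC D₂)
    × (Nor1 D₁ ⇔ Nor1 D₂)
    × (URich≪ D₁ ⇔ URich≪ D₂)
    × (URichĈ D₁ ⇔ URichĈ D₂)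
mainTheorem14 em D₁ D₂ S (sepC , sepĈ , sep≪) =
    (λ dense → mk⇔ (extC-up dense) (extC-down sepC))
  , mk⇔ (conC-up sepC em) conC-down
  , mk⇔ (nor1-up sepC) (nor1-down sepC)
  , mk⇔ (const (uRich≪ sep≪)) (uRich≪-down sepC)
  , mk⇔ (const (uRichĈ sepĈ)) (uRichĈ-down sepC)
  where open EDCSublatticeProperties S
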